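{- Let $\sim$ be an $\mathbf L$-equality on a set $X$ and let $M\subseteq L^X$ be a subset containing only $\mathbf L$-sets compatible with $\sim$. Then the restriction of the power relation $\sim^{+}$ to $M$ is an $\mathbf L$-equality on $M$, and it equals the restriction of $\approx^X$ to $M$.
   Context: $\mathbf L=\langle L,\wedge,\vee,\otimes,\to,0,1\rangle$ is a complete residuated lattice ($\langle L,\wedge,\vee,0,1\rangle$ complete lattice, $\langle L,\otimes,1\rangle$ commutative monoid, $a\otimes b\le c$ iff $a\le b\to c$). An $\mathbf L$-set in $X$ is a map $X\to L$, $L^X$ the set of them. $S(A,B)=\bigwedge_{x\in X}(A(x)\to B(x))$ and $A\approx^X B=S(A,B)\wedge S(B,A)$. A binary $\mathbf L$-relation on $X$ is a map $X\times X\to L$; an $\mathbf L$-equality is one that is reflexive ($x\sim x=1$), symmetric, transitive ($(x\sim y)\otimes(y\sim z)\le x\sim z$) and with $x\sim y=1\Rightarrow x=y$. An $\mathbf L$-set $A$ is compatible with $\sim$ if $A(x)\otimes(x\sim x')\le A(x')$ for all $x,x'$. For a binary $\mathbf L$-relation $R$ on $X$ and $A,B\in L^X$: $(R\circ B)(x)=\bigvee_y R(x,y)\otimes B(y)$, $(A\circ R)(y)=\bigvee_x A(x)\otimes R(x,y)$ and $R^+(A,B)=S(A,R\circ B)\wedge S(B,A\circ R)$. -}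

module Defs where

open import Level using (0ℓ)
open import Data.Product using (Σ; _×_; _,_; proj₁; proj₂)
open import Relation.Binary.PropositionalEquality using (_≡_)
open import Relation.Binary.Structures using (IsPartialOrder)

record CompleteResiduatedLattice : Set₁ where
  infixr 6 _∨_
  infixr 7 _∧_
  infixr 7 _⊗_
  infixr 5 _⇒_
  infix 4 _≤_
  field
    Carrier : Set
    _≤_ : Carrier → Carrier → Set
    ≤-isPartialOrder : IsPartialOrder _≡_ _≤_
    ⋀ : {I : Set} → (I → Carrier) → Carrier
    ⋀-lb : ∀ {I : Set} (f : I → Carrier) (i : I) → ⋀ f ≤ f i
    ⋀-glb : ∀ {I : Set} (f : I → Carrier) (a : Carrier) → (∀ i → a ≤ f i) → a ≤ ⋀ f
    ⋁ : {I : Set} → (I → Carrier) → Carrier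
    ⋁-ub : ∀ {I : Set} (f : I → Carrier) (i : I) → f i ≤ ⋁ f
    ⋁-lub : ∀ {I : Set} (f : I → Carrier) (a : Carrier) → (∀ i → f i ≤ a) → ⋁ f ≤ a
    _∧_ : Carrier → Carrier → Carrier
    ∧-lb₁ : ∀ a b → a ∧ b ≤ a
    ∧-lb₂ : ∀ a b → a ∧ b ≤ b
    ∧-glb : ∀ a b c → c ≤ a → c ≤ b → c ≤ a ∧ b
    _∨_ : Carrier → Carrier → Carrier
    ∨-ub₁ : ∀ a b → a ≤ a ∨ b
    ∨-ub₂ : ∀ a b → b ≤ a ∨ b
    ∨-lub : ∀ a b c → a ≤ c → b ≤ c → a ∨ b ≤ c
    𝟘 : Carrier
    𝟙 : Carrier
    𝟘-least : ∀ a → 𝟘 ≤ a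
    𝟙-greatest : ∀ a → a ≤ 𝟙
    _⊗_ : Carrier → Carrier → Carrier
    ⊗-assoc : ∀ a b c → (a ⊗ b) ⊗ c ≡ a ⊗ (b ⊗ c)
    ⊗-comm : ∀ a b → a ⊗ b ≡ b ⊗ a
    ⊗-identityʳ : ∀ a → a ⊗ 𝟙 ≡ a
    _⇒_ : Carrier → Carrier → Carrier
    adjoint₁ : ∀ a b c → a ⊗ b ≤ c → a ≤ b ⇒ c
    adjoint₂ : ∀ a b c → a ≤ b ⇒ c → a ⊗ b ≤ c

module _ (𝐋 : CompleteResiduatedLattice) where
  open CompleteResiduatedLattice 𝐋

  LSet : Set → Set
  LSet X = X → Carrier

  Sub : {X : Set} → LSet X → LSet X → Carrier
  Sub A B = ⋀ (λ x → A x ⇒ B x)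

  EqDeg : {X : Set} → LSet X → LSet X → Carrier
  EqDeg A B = Sub A B ∧ Sub B A

  record IsLEquality {X : Set} (_≈_ : X → X → Set) (E : X → X → Carrier) : Set where
    field
      reflexive  : ∀ x → E x x ≡ 𝟙
      symmetric  : ∀ x y → E x y ≡ E y x
      transitive : ∀ x y z → E x y ⊗ E y z ≤ E x z
      separating : ∀ x y → E x y ≡ 𝟙 → x ≈ y

  Compatible : {X : Set} → (X → X → Carrier) → LSet X → Set
  Compatible E A = ∀ x x' → A x ⊗ E x x' ≤ A x'

  compR : {X : Set} → (X → X → Carrier) → LSet X → LSet X
  compR R B x = ⋁ (λ y → R x y ⊗ B y)

  compL : {X : Set} → LSet X → (X → X → Carrier) → LSet X
  compL A R y = ⋁ (λ x → A x ⊗ R x y)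

  Power : {X : Set} → (X → X → Carrier) → LSet X → LSet X → Carrier
  Power R A B = Sub A (compR R B) ∧ Sub B (compL A R)

-- Compatibility makes the power relation collapse: for a compatible B,
-- reflexivity of ∼ gives B ⊆ ∼ ∘ B and compatibility (with symmetry) gives
-- ∼ ∘ B ⊆ B, so ∼ ∘ B = B, and likewise A ∘ ∼ = A.  Hence ∼⁺(A, B) is
-- S(A, B) ∧ S(B, A) = A ≈ˣ B on M, and ≈ˣ is an L-equality on all of Lˣ.
module Submission where

open import Defs
open import Data.Product using (Σ; _×_; proj₁; _,_)
open import Relation.Binary.Bundles using (Poset)
open import Relation.Binary.PropositionalEquality
  using (_≡_; refl; sym; trans; cong; cong₂)
open import Relation.Binary.Structures using (IsPartialOrder)
import Relation.Binary.Reasoning.PartialOrder as PosetReasoning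

module ResiduatedLattice (𝐋 : CompleteResiduatedLattice) where
  open CompleteResiduatedLattice 𝐋
  open IsPartialOrder ≤-isPartialOrder
    using (antisym) renaming (refl to ≤-refl; reflexive to ≤-reflexive; trans to ≤-trans)

  poset : Poset _ _ _
  poset = record { isPartialOrder = ≤-isPartialOrder }

  open PosetReasoning poset

  ⊗-identityˡ : ∀ a → 𝟙 ⊗ a ≡ a
  ⊗-identityˡ a = trans (⊗-comm 𝟙 a) (⊗-identityʳ a)

  ⊗-monoˡ : ∀ {a b} c → a ≤ b → a ⊗ c ≤ b ⊗ c
  ⊗-monoˡ {a} {b} c a≤b = adjoint₂ a c (b ⊗ c) (≤-trans a≤b (adjoint₁ b c (b ⊗ c) ≤-refl))

  ⊗-monoʳ : ∀ c {a b} → a ≤ b → c ⊗ a ≤ c ⊗ b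
  ⊗-monoʳ c {a} {b} a≤b = begin
    c ⊗ a  ≡⟨ ⊗-comm c a ⟩
    a ⊗ c  ≤⟨ ⊗-monoˡ c a≤b ⟩
    b ⊗ c  ≡⟨ ⊗-comm b c ⟩
    c ⊗ b  ∎

  ⊗-mono : ∀ {a b c d} → a ≤ b → c ≤ d → a ⊗ c ≤ b ⊗ d
  ⊗-mono {b = b} {c} a≤b c≤d = ≤-trans (⊗-monoˡ c a≤b) (⊗-monoʳ b c≤d)

  ⇒-eval : ∀ a b → (a ⇒ b) ⊗ a ≤ b
  ⇒-eval a b = adjoint₂ (a ⇒ b) a b ≤-refl

  ⇒-monoʳ : ∀ a {b c} → b ≤ c → a ⇒ b ≤ a ⇒ c
  ⇒-monoʳ a {b} {c} b≤c = adjoint₁ (a ⇒ b) a c (≤-trans (⇒-eval a b) b≤c)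

  ∧-comm : ∀ a b → a ∧ b ≡ b ∧ a
  ∧-comm a b = antisym (swap a b) (swap b a)
    where
    swap : ∀ a b → a ∧ b ≤ b ∧ a
    swap a b = ∧-glb b a (a ∧ b) (∧-lb₂ a b) (∧-lb₁ a b)

  module _ {X : Set} where

    _≐_ : LSet 𝐋 X → LSet 𝐋 X → Set
    A ≐ B = ∀ x → A x ≡ B x

    Sub-eval : (A B : LSet 𝐋 X) (x : X) → Sub 𝐋 A B ⊗ A x ≤ B x
    Sub-eval A B x = ≤-trans (⊗-monoˡ (A x) (⋀-lb _ x)) (⇒-eval (A x) (B x))

    Sub-monoʳ : (A : LSet 𝐋 X) {B C : LSet 𝐋 X} → (∀ x → B x ≤ C x) → Sub 𝐋 A B ≤ Sub 𝐋 A C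
    Sub-monoʳ A B⊆C = ⋀-glb _ _ λ x → ≤-trans (⋀-lb _ x) (⇒-monoʳ (A x) (B⊆C x))

    Sub-congʳ : (A : LSet 𝐋 X) {B C : LSet 𝐋 X} → B ≐ C → Sub 𝐋 A B ≡ Sub 𝐋 A C
    Sub-congʳ A B≐C = antisym
      (Sub-monoʳ A λ x → ≤-reflexive (B≐C x))
      (Sub-monoʳ A λ x → ≤-reflexive (sym (B≐C x)))

    Sub-refl : (A : LSet 𝐋 X) → Sub 𝐋 A A ≡ 𝟙
    Sub-refl A = antisym (𝟙-greatest _)
      (⋀-glb _ 𝟙 λ x → adjoint₁ 𝟙 (A x) (A x) (≤-reflexive (⊗-identityˡ (A x))))

    Sub-trans : (A B C : LSet 𝐋 X) → Sub 𝐋 A B ⊗ Sub 𝐋 B C ≤ Sub 𝐋 A C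
    Sub-trans A B C = ⋀-glb _ _ λ x → adjoint₁ _ (A x) (C x) (begin
      (Sub 𝐋 A B ⊗ Sub 𝐋 B C) ⊗ A x  ≡⟨ cong (_⊗ A x) (⊗-comm (Sub 𝐋 A B) (Sub 𝐋 B C)) ⟩
      (Sub 𝐋 B C ⊗ Sub 𝐋 A B) ⊗ A x  ≡⟨ ⊗-assoc (Sub 𝐋 B C) (Sub 𝐋 A B) (A x) ⟩
      Sub 𝐋 B C ⊗ (Sub 𝐋 A B ⊗ A x)  ≤⟨ ⊗-monoʳ (Sub 𝐋 B C) (Sub-eval A B x) ⟩
      Sub 𝐋 B C ⊗ B x                ≤⟨ Sub-eval B C x ⟩
      C x                            ∎)

    Sub-𝟙⇒⊆ : (A B : LSet 𝐋 X) → 𝟙 ≤ Sub 𝐋 A B → ∀ x → A x ≤ B x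
    Sub-𝟙⇒⊆ A B 𝟙≤S x = begin
      A x              ≡⟨ sym (⊗-identityˡ (A x)) ⟩
      𝟙 ⊗ A x          ≤⟨ ⊗-monoˡ (A x) 𝟙≤S ⟩
      Sub 𝐋 A B ⊗ A x  ≤⟨ Sub-eval A B x ⟩
      B x              ∎

    EqDeg-isLEquality : IsLEquality 𝐋 _≐_ (EqDeg 𝐋 {X})
    EqDeg-isLEquality = record
      { reflexive  = λ A → trans (cong₂ _∧_ (Sub-refl A) (Sub-refl A)) (∧-idem 𝟙)
      ; symmetric  = λ A B → ∧-comm (Sub 𝐋 A B) (Sub 𝐋 B A)
      ; transitive = λ A B C → ∧-glb _ _ _
          (≤-trans (⊗-mono (∧-lb₁ _ _) (∧-lb₁ _ _)) (Sub-trans A B C))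
          (≤-trans (⊗-mono (∧-lb₂ _ _) (∧-lb₂ _ _))
            (≤-trans (≤-reflexive (⊗-comm _ _)) (Sub-trans C B A)))
      ; separating = λ A B ≈𝟙 x → antisym
          (Sub-𝟙⇒⊆ A B (≤-trans (≤-reflexive (sym ≈𝟙)) (∧-lb₁ _ _)) x)
          (Sub-𝟙⇒⊆ B A (≤-trans (≤-reflexive (sym ≈𝟙)) (∧-lb₂ _ _)) x)
      }
      where
      ∧-idem : ∀ a → a ∧ a ≡ a
      ∧-idem a = antisym (∧-lb₁ a a) (∧-glb a a a ≤-refl ≤-refl)

    module _ {E : X → X → Carrier} (isE : IsLEquality 𝐋 _≡_ E) where
      open IsLEquality isE

      compR-compatible : (B : LSet 𝐋 X) → Compatible 𝐋 E B → compR 𝐋 E B ≐ B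
      compR-compatible B compatible x = antisym
        (⋁-lub _ (B x) λ y → begin
          E x y ⊗ B y  ≡⟨ cong₂ _⊗_ (symmetric x y) refl ⟩
          E y x ⊗ B y  ≡⟨ ⊗-comm (E y x) (B y) ⟩
          B y ⊗ E y x  ≤⟨ compatible y x ⟩
          B x          ∎)
        (begin
          B x          ≡⟨ sym (trans (cong (_⊗ B x) (reflexive x)) (⊗-identityˡ (B x))) ⟩
          E x x ⊗ B x  ≤⟨ ⋁-ub (λ y → E x y ⊗ B y) x ⟩
          compR 𝐋 E B x ∎)

      compL-compatible : (A : LSet 𝐋 X) → Compatible 𝐋 E A → compL 𝐋 A E ≐ A
      compL-compatible A compatible y = antisym
        (⋁-lub _ (A y) λ x → compatible x y)
        (begin
          A y          ≡⟨ sym (trans (cong (A y ⊗_) (reflexive y)) (⊗-identityʳ (A y))) ⟩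
          A y ⊗ E y y  ≤⟨ ⋁-ub (λ x → A x ⊗ E x y) y ⟩
          compL 𝐋 A E y ∎)

      Power-compatible : (A B : LSet 𝐋 X) → Compatible 𝐋 E A → Compatible 𝐋 E B
                       → Power 𝐋 E A B ≡ EqDeg 𝐋 A B
      Power-compatible A B compatibleA compatibleB = cong₂ _∧_
        (Sub-congʳ A (compR-compatible B compatibleB))
        (Sub-congʳ B (compL-compatible A compatibleA))

  module _ {Y : Set} {_≈_ : Y → Y → Set} {G : Y → Y → Carrier} where

    IsLEquality-cong : {F : Y → Y → Carrier} → (∀ a b → F a b ≡ G a b) → IsLEquality 𝐋 _≈_ G → IsLEquality 𝐋 _≈_ F
    IsLEquality-cong {F} F≡G isG = record
      { reflexive  = λ a → trans (F≡G a a) (reflexive a)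
      ; symmetric  = λ a b → trans (F≡G a b) (trans (symmetric a b) (sym (F≡G b a)))
      ; transitive = λ a b c → begin
          F a b ⊗ F b c  ≡⟨ cong₂ _⊗_ (F≡G a b) (F≡G b c) ⟩
          G a b ⊗ G b c  ≤⟨ transitive a b c ⟩
          G a c          ≡⟨ sym (F≡G a c) ⟩
          F a c          ∎
      ; separating = λ a b Fab≡𝟙 → separating a b (trans (sym (F≡G a b)) Fab≡𝟙)
      }
      where open IsLEquality isG

    IsLEquality-on : {Z : Set} (f : Z → Y) → IsLEquality 𝐋 _≈_ G
                   → IsLEquality 𝐋 (λ a b → f a ≈ f b) (λ a b → G (f a) (f b))
    IsLEquality-on f isG = record
      { reflexive  = λ a → reflexive (f a)
      ; symmetric  = λ a b → symmetric (f a) (f b)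
      ; transitive = λ a b c → transitive (f a) (f b) (f c)
      ; separating = λ a b → separating (f a) (f b)
      }
      where open IsLEquality isG

theorem5 : (𝐋 : CompleteResiduatedLattice) {X : Set}
           (E : X → X → CompleteResiduatedLattice.Carrier 𝐋)
           → IsLEquality 𝐋 _≡_ E
           → (M : LSet 𝐋 X → Set)
           → (∀ A → M A → Compatible 𝐋 E A)
           → IsLEquality 𝐋 {Σ (LSet 𝐋 X) M}
               (λ A B → ∀ x → proj₁ A x ≡ proj₁ B x)
               (λ A B → Power 𝐋 E (proj₁ A) (proj₁ B))
             × (∀ (A B : Σ (LSet 𝐋 X) M)
                → Power 𝐋 E (proj₁ A) (proj₁ B) ≡ EqDeg 𝐋 (proj₁ A) (proj₁ B))
theorem5 𝐋 {X} E isE M compatible =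
  IsLEquality-cong Power≡EqDeg (IsLEquality-on proj₁ EqDeg-isLEquality) , Power≡EqDeg
  where
  open ResiduatedLattice 𝐋

  Power≡EqDeg : ∀ (A B : Σ (LSet 𝐋 X) M)
              → Power 𝐋 E (proj₁ A) (proj₁ B) ≡ EqDeg 𝐋 (proj₁ A) (proj₁ B)
  Power≡EqDeg (A , A∈M) (B , B∈M) =
    Power-compatible isE A B (compatible A A∈M) (compatible B B∈M)
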